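{- Let $G=(V,E)$ be a graph with nonnegative edge weights and no self-loops, with $|V|=n\ge 2$, and let $w(E)$ denote the total weight of its edges. If $w(E)\ge d(n-1)$, then there is a set $S\subseteq V$ with $|S|\ge 2$ such that the induced subgraph $G[S]$ is strongly $d$-connected, i.e., every cut of $G[S]$ has total weight at least $d$.
   Context: For $S\subseteq V$, $G[S]$ is the vertex-induced subgraph; a cut of $G[S]$ is a bipartition of $S$ into two nonempty parts, and its weight is the total weight of edges of $G[S]$ between the parts.
   Formalization: The edge weights and the parameter d are rational. -}

module Defs where

open import Data.Nat using (ℕ; zero; suc)
open import Data.Fin using (Fin; zero; suc; _<_)
open import Data.Fin.Properties using (_<?_)
open import Data.Fin.Subset using (Subset; Side; inside; outside; _⊆_; _─_; Nonempty)
open import Data.Vec using (lookup)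
open import Data.Rational using (ℚ; 0ℚ; _+_; _≤_)
open import Relation.Nullary using (yes; no)

-- Weighted graph on vertex set Fin n: a weight function on ordered pairs,
-- required (in the statement) to be symmetric, nonnegative and zero on the diagonal.
Weight : ℕ → Set
Weight n = Fin n → Fin n → ℚ

ΣFin : (n : ℕ) → (Fin n → ℚ) → ℚ
ΣFin zero    f = 0ℚ
ΣFin (suc n) f = f zero + ΣFin n (λ i → f (suc i))

Symmetric : {n : ℕ} → Weight n → Set
Symmetric w = ∀ i j → w i j ≡' w j i
  where open import Relation.Binary.PropositionalEquality renaming (_≡_ to _≡'_)

NonNegative : {n : ℕ} → Weight n → Set
NonNegative w = ∀ i j → 0ℚ ≤ w i j

NoSelfLoops : {n : ℕ} → Weight n → Set
NoSelfLoops w = ∀ i → w i i ≡' 0ℚ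
  where open import Relation.Binary.PropositionalEquality renaming (_≡_ to _≡'_)

totalWeight : {n : ℕ} → Weight n → ℚ
totalWeight {n} w = ΣFin n (λ i → ΣFin n (λ j → pick i j))
  where
  pick : Fin n → Fin n → ℚ
  pick i j with i <? j
  ... | yes _ = w i j
  ... | no  _ = 0ℚ

restrict : {n : ℕ} → Subset n → Subset n → Weight n → Fin n → Fin n → ℚ
restrict A B w i j with lookup A i | lookup B j
... | inside | inside = w i j
... | _      | _      = 0ℚ

crossWeight : {n : ℕ} → Weight n → Subset n → Subset n → ℚ
crossWeight {n} w A B = ΣFin n (λ i → ΣFin n (λ j → restrict A B w i j))

StronglyConnected : {n : ℕ} → Weight n → ℚ → Subset n → Set
StronglyConnected w d S =
  ∀ A → A ⊆ S → Nonempty A → Nonempty (S ─ A) → d ≤ crossWeight w A (S ─ A)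

{-# OPTIONS --safe #-}
-- Write e(S) for the weight of the edges of G[S] and σ(S) = 2 (e(S) − d (|S| − 1)) for the surplus
-- of S, so that the hypothesis reads σ(V) ≥ 0. If a set S with σ(S) ≥ 0 and |S| ≥ 2 has a cut
-- (A, S − A) of weight X < d, then σ(S) = σ(A) + σ(S − A) − 2 (d − X), so one side T of the cut has
-- σ(T) > 0. Singletons have surplus 0, so |T| ≥ 2 and we may recurse into the proper subset T.
-- The recursion stops at a set with at least two vertices and no cut of weight below d.
module Submission where

open import Defs
open import Data.Nat using (ℕ; _∸_)
open import Data.Nat using () renaming (_≤_ to _≤ℕ_)
open import Data.Fin.Subset using (Subset; ∣_∣)
open import Data.Rational using (ℚ; _≤_; _*_)
open import Data.Rational using (_/_)
open import Data.Integer using (+_)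
open import Data.Product using (Σ; _×_)

open import Data.Bool using (Bool; true; false; _∧_; not; if_then_else_)
open import Data.Bool.Properties using (∧-comm; ∧-zeroʳ; ∧-identityʳ)
open import Data.Fin using (Fin; zero; suc)
import Data.Fin.Properties as Finₚ
open import Data.Fin.Subset using (inside; outside; _∈_; _∉_; _⊆_; _⊂_; _─_; ⊤; Nonempty)
open import Data.Fin.Subset.Induction using (Acc; acc; ⊂-wellFounded)
open import Data.Fin.Subset.Properties
  using (drop-∷-⊆; ∣⊤∣≡n; p─q⊆p; p∩q≢∅⇒p─q⊂p; x∈p∩q⁺; x∈p⇒∣p-x∣<∣p∣; x∈p∧x≢y⇒x∈p-y;
         _⊆?_; nonempty?; anySubset?)
import Data.Integer as ℤ
import Data.Integer.Properties as ℤₚ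
open import Data.Nat as ℕ using (zero; suc; z≤n; s≤s)
import Data.Nat.Properties as ℕₚ
open import Data.Product using (∃; _,_; proj₁)
open import Data.Rational using (0ℚ; 1ℚ; _+_; -_; _-_; _<_; toℚᵘ)
open import Data.Rational.Properties
  using (+-0-commutativeMonoid; +-identityˡ; +-identityʳ; *-zeroʳ; +-mono-≤; +-monoˡ-≤; +-mono-<;
         +-mono-≤-<; <-irrefl; <⇒≤; ≮⇒≥; _<?_; module ≤-Reasoning;
         toℚᵘ-injective; toℚᵘ-fromℚᵘ; toℚᵘ-homo-+)
open import Data.Rational.Solver using (module +-*-Solver)
open import Algebra.Properties.CommutativeMonoid.Sum +-0-commutativeMonoid
  using (sum; ∑-distrib-+; ∑-comm; sum-replicate-zero)
import Data.Rational.Unnormalised as ℚᵘ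
import Data.Rational.Unnormalised.Properties as ℚᵘₚ
open import Data.Sum using (_⊎_; inj₁; inj₂)
open import Data.Vec using (_∷_; []; lookup; here; there)
open import Data.Vec.Properties using ([]=⇒lookup; lookup⇒[]=; lookup-replicate)
open import Function using (_∘_)
open import Relation.Binary.PropositionalEquality
open import Relation.Nullary using (Dec; yes; no; contradiction)
open import Relation.Nullary.Decidable using (_×-dec_)

open +-*-Solver using (solve; _:=_; _:+_; _:*_; _:-_; con)

fromℕ : ℕ → ℚ
fromℕ k = + k / 1

fromℕ-homo-+ : ∀ a b → fromℕ (a ℕ.+ b) ≡ fromℕ a + fromℕ b
fromℕ-homo-+ a b = toℚᵘ-injective (begin
  toℚᵘ (fromℕ (a ℕ.+ b))              ≈⟨ toℚᵘ-fromℚᵘ (ℕ→ℚᵘ (a ℕ.+ b)) ⟩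
  ℕ→ℚᵘ (a ℕ.+ b)                      ≈⟨ ℚᵘₚ.≃-reflexive (cong (λ z → ℚᵘ.mkℚᵘ z 0) unnormalised-sum) ⟩
  ℕ→ℚᵘ a ℚᵘ.+ ℕ→ℚᵘ b                  ≈⟨ ℚᵘₚ.+-cong (toℚᵘ-fromℚᵘ (ℕ→ℚᵘ a)) (toℚᵘ-fromℚᵘ (ℕ→ℚᵘ b)) ⟨
  toℚᵘ (fromℕ a) ℚᵘ.+ toℚᵘ (fromℕ b)  ≈⟨ toℚᵘ-homo-+ (fromℕ a) (fromℕ b) ⟨
  toℚᵘ (fromℕ a + fromℕ b)            ∎)
  where
  open ℚᵘₚ.≃-Reasoning
  ℕ→ℚᵘ : ℕ → ℚᵘ.ℚᵘ
  ℕ→ℚᵘ k = ℚᵘ.mkℚᵘ (+ k) 0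
  unnormalised-sum : + (a ℕ.+ b) ≡ + a ℤ.* + 1 ℤ.+ + b ℤ.* + 1
  unnormalised-sum = trans (ℤₚ.pos-+ a b) (sym (cong₂ ℤ._+_ (ℤₚ.*-identityʳ (+ a)) (ℤₚ.*-identityʳ (+ b))))

ΣFin≡sum : ∀ n (f : Fin n → ℚ) → ΣFin n f ≡ sum f
ΣFin≡sum zero    f = refl
ΣFin≡sum (suc n) f = cong (λ s → f zero + s) (ΣFin≡sum n (λ i → f (suc i)))

ΣFin-cong : ∀ n {f g : Fin n → ℚ} → (∀ i → f i ≡ g i) → ΣFin n f ≡ ΣFin n g
ΣFin-cong zero    f≗g = refl
ΣFin-cong (suc n) f≗g = cong₂ _+_ (f≗g zero) (ΣFin-cong n (λ i → f≗g (suc i)))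

ΣFin-distrib-+ : ∀ n (f g : Fin n → ℚ) → ΣFin n (λ i → f i + g i) ≡ ΣFin n f + ΣFin n g
ΣFin-distrib-+ n f g = begin
  ΣFin n (λ i → f i + g i) ≡⟨ ΣFin≡sum n _ ⟩
  sum (λ i → f i + g i)    ≡⟨ ∑-distrib-+ f g ⟩
  sum f + sum g            ≡⟨ cong₂ _+_ (ΣFin≡sum n f) (ΣFin≡sum n g) ⟨
  ΣFin n f + ΣFin n g      ∎
  where open ≡-Reasoning

ΣFin-comm : ∀ m n (f : Fin m → Fin n → ℚ) →
            ΣFin m (λ i → ΣFin n (f i)) ≡ ΣFin n (λ j → ΣFin m (λ i → f i j))
ΣFin-comm m n f = begin
  ΣFin m (λ i → ΣFin n (f i))          ≡⟨ ΣFin-cong m (λ i → ΣFin≡sum n (f i)) ⟩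
  ΣFin m (λ i → sum (f i))             ≡⟨ ΣFin≡sum m _ ⟩
  sum (λ i → sum (f i))                ≡⟨ ∑-comm f ⟩
  sum (λ j → sum (λ i → f i j))        ≡⟨ ΣFin≡sum n _ ⟨
  ΣFin n (λ j → sum (λ i → f i j))     ≡⟨ ΣFin-cong n (λ j → ΣFin≡sum m (λ i → f i j)) ⟨
  ΣFin n (λ j → ΣFin m (λ i → f i j))  ∎
  where open ≡-Reasoning

ΣFin-zero : ∀ n → ΣFin n (λ _ → 0ℚ) ≡ 0ℚ
ΣFin-zero n = trans (ΣFin≡sum n _) (sum-replicate-zero n)

lookup-─ : ∀ {n} (p q : Subset n) i → lookup (p ─ q) i ≡ lookup p i ∧ not (lookup q i)
lookup-─ (x ∷ p) (inside  ∷ q) zero    = sym (∧-zeroʳ x)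
lookup-─ (x ∷ p) (outside ∷ q) zero    = sym (∧-identityʳ x)
lookup-─ (_ ∷ p) (_       ∷ q) (suc i) = lookup-─ p q i

lookup-⊆ : ∀ {n} {p q : Subset n} → p ⊆ q → ∀ i → lookup p i ≡ inside → lookup q i ≡ inside
lookup-⊆ {p = p} p⊆q i p[i] = []=⇒lookup (p⊆q (lookup⇒[]= i p p[i]))

x∈p─q⇒x∉q : ∀ {n} {p q : Subset n} {x} → x ∈ p ─ q → x ∉ q
x∈p─q⇒x∉q {p = _ ∷ _} {outside ∷ _} here           ()
x∈p─q⇒x∉q {p = _ ∷ _} {_       ∷ _} (there x∈p─q) (there x∈q) = x∈p─q⇒x∉q x∈p─q x∈q

∣p∣≡∣q∣+∣p─q∣ : ∀ {n} {p q : Subset n} → q ⊆ p → ∣ p ∣ ≡ ∣ q ∣ ℕ.+ ∣ p ─ q ∣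
∣p∣≡∣q∣+∣p─q∣ {p = []}          {[]}          _   = refl
∣p∣≡∣q∣+∣p─q∣ {p = outside ∷ p} {inside  ∷ q} q⊆p = contradiction (q⊆p here) λ ()
∣p∣≡∣q∣+∣p─q∣ {p = inside  ∷ p} {inside  ∷ q} q⊆p = cong suc (∣p∣≡∣q∣+∣p─q∣ (drop-∷-⊆ q⊆p))
∣p∣≡∣q∣+∣p─q∣ {p = inside  ∷ p} {outside ∷ q} q⊆p =
  trans (cong suc (∣p∣≡∣q∣+∣p─q∣ (drop-∷-⊆ q⊆p))) (sym (ℕₚ.+-suc ∣ q ∣ ∣ p ─ q ∣))
∣p∣≡∣q∣+∣p─q∣ {p = outside ∷ p} {outside ∷ q} q⊆p = ∣p∣≡∣q∣+∣p─q∣ (drop-∷-⊆ q⊆p)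

x∈p⇒1≤∣p∣ : ∀ {n} {p : Subset n} {x} → x ∈ p → 1 ≤ℕ ∣ p ∣
x∈p⇒1≤∣p∣ x∈p = ℕₚ.≤-trans (s≤s z≤n) (x∈p⇒∣p-x∣<∣p∣ x∈p)

x∈p∧y∈p∧x≢y⇒2≤∣p∣ : ∀ {n} {p : Subset n} {x y} → x ∈ p → y ∈ p → x ≢ y → 2 ≤ℕ ∣ p ∣
x∈p∧y∈p∧x≢y⇒2≤∣p∣ x∈p y∈p x≢y =
  ℕₚ.≤-trans (s≤s (x∈p⇒1≤∣p∣ (x∈p∧x≢y⇒x∈p-y y∈p (x≢y ∘ sym)))) (x∈p⇒∣p-x∣<∣p∣ x∈p)

q⊆p∧p─q≢∅⇒q⊂p : ∀ {n} {p q : Subset n} → q ⊆ p → Nonempty (p ─ q) → q ⊂ p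
q⊆p∧p─q≢∅⇒q⊂p {p = p} {q} q⊆p (x , x∈p─q) = q⊆p , x , p─q⊆p p q x∈p─q , x∈p─q⇒x∉q x∈p─q

q⊆p∧q≢∅⇒p─q⊂p : ∀ {n} {p q : Subset n} → q ⊆ p → Nonempty q → p ─ q ⊂ p
q⊆p∧q≢∅⇒p─q⊂p {p = p} {q} q⊆p (x , x∈q) = p∩q≢∅⇒p─q⊂p p q (x , x∈p∩q⁺ (q⊆p x∈q , x∈q))

if-∧-split : ∀ a s c (x : ℚ) → (a ≡ true → s ≡ true) →
             (if s ∧ c then x else 0ℚ) ≡ (if a ∧ c then x else 0ℚ) + (if (s ∧ not a) ∧ c then x else 0ℚ)
if-∧-split true  true  true  x _   = sym (+-identityʳ x)
if-∧-split true  true  false x _   = refl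
if-∧-split true  false c     x a⇒s = contradiction (a⇒s refl) λ ()
if-∧-split false true  true  x _   = sym (+-identityˡ x)
if-∧-split false true  false x _   = refl
if-∧-split false false c     x _   = refl

module _ {n : ℕ} (w : Weight n) where
  restrict-if : ∀ (A B : Subset n) i j → restrict A B w i j ≡ (if lookup A i ∧ lookup B j then w i j else 0ℚ)
  restrict-if A B i j with lookup A i | lookup B j
  ... | true  | true  = refl
  ... | true  | false = refl
  ... | false | _     = refl

  restrict-splitˡ : ∀ {S A} C → A ⊆ S → ∀ i j →
                    restrict S C w i j ≡ restrict A C w i j + restrict (S ─ A) C w i j
  restrict-splitˡ {S} {A} C A⊆S i j = begin
    restrict S C w i j
      ≡⟨ restrict-if S C i j ⟩
    weightIf (lookup S i)
      ≡⟨ if-∧-split (lookup A i) (lookup S i) (lookup C j) (w i j) (lookup-⊆ A⊆S i) ⟩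
    weightIf (lookup A i) + weightIf (lookup S i ∧ not (lookup A i))
      ≡⟨ cong₂ _+_ (restrict-if A C i j) (trans (restrict-if (S ─ A) C i j) (cong weightIf (lookup-─ S A i))) ⟨
    restrict A C w i j + restrict (S ─ A) C w i j
      ∎
    where
    open ≡-Reasoning
    weightIf : Bool → ℚ
    weightIf b = if b ∧ lookup C j then w i j else 0ℚ

  crossWeight-splitˡ : ∀ {S A} C → A ⊆ S → crossWeight w S C ≡ crossWeight w A C + crossWeight w (S ─ A) C
  crossWeight-splitˡ {S} {A} C A⊆S = begin
    crossWeight w S C
      ≡⟨ ΣFin-cong n (λ i → ΣFin-cong n (restrict-splitˡ C A⊆S i)) ⟩
    ΣFin n (λ i → ΣFin n (λ j → restrict A C w i j + restrict (S ─ A) C w i j))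
      ≡⟨ ΣFin-cong n (λ i → ΣFin-distrib-+ n _ _) ⟩
    ΣFin n (λ i → ΣFin n (restrict A C w i) + ΣFin n (restrict (S ─ A) C w i))
      ≡⟨ ΣFin-distrib-+ n _ _ ⟩
    crossWeight w A C + crossWeight w (S ─ A) C
      ∎
    where open ≡-Reasoning

  restrict-⊤ : ∀ i j → restrict ⊤ ⊤ w i j ≡ w i j
  restrict-⊤ i j = trans (restrict-if ⊤ ⊤ i j)
    (cong₂ (λ a b → if a ∧ b then w i j else 0ℚ) (lookup-replicate i inside) (lookup-replicate j inside))

  crossWeight-⊤ : crossWeight w ⊤ ⊤ ≡ ΣFin n (λ i → ΣFin n (w i))
  crossWeight-⊤ = ΣFin-cong n (λ i → ΣFin-cong n (restrict-⊤ i))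

  crossWeight-∣S∣≤1 : NoSelfLoops w → ∀ {S} → ∣ S ∣ ≤ℕ 1 → crossWeight w S S ≡ 0ℚ
  crossWeight-∣S∣≤1 no-loops {S} ∣S∣≤1 = begin
    crossWeight w S S                  ≡⟨ ΣFin-cong n (λ i → ΣFin-cong n (restrict-≡0 i)) ⟩
    ΣFin n (λ _ → ΣFin n (λ _ → 0ℚ))  ≡⟨ ΣFin-cong n (λ _ → ΣFin-zero n) ⟩
    ΣFin n (λ _ → 0ℚ)                  ≡⟨ ΣFin-zero n ⟩
    0ℚ                                 ∎
    where
    open ≡-Reasoning
    restrict-≡0 : ∀ i j → restrict S S w i j ≡ 0ℚ
    restrict-≡0 i j rewrite restrict-if S S i j with lookup S i in i∈S | lookup S j in j∈S
    ... | false | _     = refl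
    ... | true  | false = refl
    ... | true  | true  with i Finₚ.≟ j
    ...   | yes refl = no-loops i
    ...   | no  i≢j  = contradiction (x∈p∧y∈p∧x≢y⇒2≤∣p∣ (lookup⇒[]= i S i∈S) (lookup⇒[]= j S j∈S) i≢j)
                                     (ℕₚ.<⇒≱ (s≤s ∣S∣≤1))

  module _ (sym-w : Symmetric w) where
    restrict-swap : ∀ A B i j → restrict A B w i j ≡ restrict B A w j i
    restrict-swap A B i j = begin
      restrict A B w i j                             ≡⟨ restrict-if A B i j ⟩
      (if lookup A i ∧ lookup B j then w i j else 0ℚ)
        ≡⟨ cong₂ (λ b x → if b then x else 0ℚ) (∧-comm (lookup A i) (lookup B j)) (sym-w i j) ⟩
      (if lookup B j ∧ lookup A i then w j i else 0ℚ) ≡⟨ restrict-if B A j i ⟨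
      restrict B A w j i                             ∎
      where open ≡-Reasoning

    crossWeight-comm : ∀ A B → crossWeight w A B ≡ crossWeight w B A
    crossWeight-comm A B = trans (ΣFin-cong n (λ i → ΣFin-cong n (restrict-swap A B i)))
                                 (ΣFin-comm n n (λ i j → restrict B A w j i))

    crossWeight-cut : ∀ {S A} → A ⊆ S →
      crossWeight w S S ≡ (crossWeight w A A + crossWeight w (S ─ A) (S ─ A))
                          + (crossWeight w A (S ─ A) + crossWeight w A (S ─ A))
    crossWeight-cut {S} {A} A⊆S = begin
      crossWeight w S S
        ≡⟨ crossWeight-splitˡ S A⊆S ⟩
      crossWeight w A S + crossWeight w B S
        ≡⟨ cong₂ _+_ (splitʳ A) (splitʳ B) ⟩
      (crossWeight w A A + crossWeight w A B) + (crossWeight w B A + crossWeight w B B)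
        ≡⟨ cong (λ y → (crossWeight w A A + crossWeight w A B) + (y + crossWeight w B B)) (crossWeight-comm B A) ⟩
      (crossWeight w A A + crossWeight w A B) + (crossWeight w A B + crossWeight w B B)
        ≡⟨ solve 3 (λ a x b → (a :+ x) :+ (x :+ b) := (a :+ b) :+ (x :+ x)) refl
                 (crossWeight w A A) (crossWeight w A B) (crossWeight w B B) ⟩
      (crossWeight w A A + crossWeight w B B) + (crossWeight w A B + crossWeight w A B)
        ∎
      where
      open ≡-Reasoning
      B : Subset n
      B = S ─ A
      splitʳ : ∀ C → crossWeight w C S ≡ crossWeight w C A + crossWeight w C B
      splitʳ C = trans (crossWeight-comm C S)
                       (trans (crossWeight-splitˡ C A⊆S) (cong₂ _+_ (crossWeight-comm A C) (crossWeight-comm B C)))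

-- The summand of totalWeight is local to its definition; unification recovers it.
upperTriangle : ∀ {n} (w : Weight n) → Σ (Fin n → Fin n → ℚ) λ u → totalWeight w ≡ ΣFin n (λ i → ΣFin n (u i))
upperTriangle w = _ , refl

module _ {n : ℕ} (w : Weight n) (sym-w : Symmetric w) (no-loops : NoSelfLoops w) where
  upper : Fin n → Fin n → ℚ
  upper = proj₁ (upperTriangle w)

  w≡upper+upperᵀ : ∀ i j → w i j ≡ upper i j + upper j i
  w≡upper+upperᵀ i j with i Finₚ.<? j | j Finₚ.<? i
  ... | yes i<j | yes j<i = contradiction j<i (Finₚ.<-asym i<j)
  ... | yes _   | no  _   = sym (+-identityʳ (w i j))
  ... | no  _   | yes _   = trans (sym-w i j) (sym (+-identityˡ (w j i)))
  ... | no  i≮j | no  j≮i = trans (cong (w i) (sym i≡j)) (no-loops i)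
    where
    i≡j : i ≡ j
    i≡j = Finₚ.≤-antisym (ℕₚ.≮⇒≥ j≮i) (ℕₚ.≮⇒≥ i≮j)

  crossWeight-⊤≡2totalWeight : crossWeight w ⊤ ⊤ ≡ totalWeight w + totalWeight w
  crossWeight-⊤≡2totalWeight = begin
    crossWeight w ⊤ ⊤
      ≡⟨ crossWeight-⊤ w ⟩
    ΣFin n (λ i → ΣFin n (w i))
      ≡⟨ ΣFin-cong n (λ i → ΣFin-cong n (w≡upper+upperᵀ i)) ⟩
    ΣFin n (λ i → ΣFin n (λ j → upper i j + upper j i))
      ≡⟨ ΣFin-cong n (λ i → ΣFin-distrib-+ n _ _) ⟩
    ΣFin n (λ i → ΣFin n (upper i) + ΣFin n (λ j → upper j i))
      ≡⟨ ΣFin-distrib-+ n _ _ ⟩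
    totalWeight w + ΣFin n (λ i → ΣFin n (λ j → upper j i))
      ≡⟨ cong (λ t → totalWeight w + t) (ΣFin-comm n n upper) ⟨
    totalWeight w + totalWeight w
      ∎
    where open ≡-Reasoning

positive-summand : ∀ {s a b x e} → 0ℚ ≤ s → s + e ≡ (a + b) + x → x < e → 0ℚ < a ⊎ 0ℚ < b
positive-summand {s} {a} {b} {x} {e} 0≤s s+e≡a+b+x x<e with 0ℚ <? a | 0ℚ <? b
... | yes 0<a | _       = inj₁ 0<a
... | no  _   | yes 0<b = inj₂ 0<b
... | no  0≮a | no  0≮b = contradiction e<e (<-irrefl refl)
  where
  open ≤-Reasoning
  e<e : e < e
  e<e = begin-strict
    e             ≡⟨ +-identityˡ e ⟨
    0ℚ + e        ≤⟨ +-monoˡ-≤ e 0≤s ⟩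
    s + e         ≡⟨ s+e≡a+b+x ⟩
    (a + b) + x   <⟨ +-mono-≤-< (+-mono-≤ (≮⇒≥ 0≮a) (≮⇒≥ 0≮b)) x<e ⟩
    (0ℚ + 0ℚ) + e ≡⟨ +-identityˡ e ⟩
    e             ∎

module _ {n : ℕ} (w : Weight n) (d : ℚ) where
  WeakCut : Subset n → Subset n → Set
  WeakCut S A = A ⊆ S × Nonempty A × Nonempty (S ─ A) × crossWeight w A (S ─ A) < d

  weakCut? : ∀ S A → Dec (WeakCut S A)
  weakCut? S A = A ⊆? S ×-dec nonempty? A ×-dec nonempty? (S ─ A) ×-dec crossWeight w A (S ─ A) <? d

  stronglyConnected⊎weakCut : ∀ S → StronglyConnected w d S ⊎ ∃ (WeakCut S)
  stronglyConnected⊎weakCut S with anySubset? (weakCut? S)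
  ... | yes cut  = inj₂ cut
  ... | no  ¬cut = inj₁ λ A A⊆S A≢∅ S─A≢∅ → ≮⇒≥ λ X<d → ¬cut (A , A⊆S , A≢∅ , S─A≢∅ , X<d)

module Surplus {n : ℕ} (w : Weight n) (sym-w : Symmetric w) (no-loops : NoSelfLoops w) (d : ℚ) where
  -- crossWeight w S S counts every edge of G[S] twice, hence the factor d + d.
  surplus : Subset n → ℚ
  surplus S = crossWeight w S S - (d + d) * (fromℕ ∣ S ∣ - 1ℚ)

  surplus-split : ∀ {S A} → A ⊆ S →
    surplus S + (d + d) ≡ (surplus A + surplus (S ─ A)) + (crossWeight w A (S ─ A) + crossWeight w A (S ─ A))
  surplus-split {S} {A} A⊆S = begin
    surplus S + (d + d)
      ≡⟨ cong₂ (λ c k → c - (d + d) * (k - 1ℚ) + (d + d))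
               (crossWeight-cut w sym-w A⊆S)
               (trans (cong fromℕ (∣p∣≡∣q∣+∣p─q∣ A⊆S)) (fromℕ-homo-+ (∣ A ∣) (∣ S ─ A ∣))) ⟩
    ((cA + cB) + (X + X)) - (d + d) * ((a + b) - 1ℚ) + (d + d)
      ≡⟨ solve 6 (λ cA cB X d a b →
                 ((cA :+ cB) :+ (X :+ X)) :- (d :+ d) :* ((a :+ b) :- con 1ℚ) :+ (d :+ d)
              := ((cA :- (d :+ d) :* (a :- con 1ℚ)) :+ (cB :- (d :+ d) :* (b :- con 1ℚ))) :+ (X :+ X))
               refl cA cB X d a b ⟩
    (surplus A + surplus (S ─ A)) + (X + X)
      ∎
    where
    open ≡-Reasoning
    cA cB X a b : ℚ
    a  = fromℕ ∣ A ∣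
    b  = fromℕ ∣ S ─ A ∣
    cA = crossWeight w A A
    cB = crossWeight w (S ─ A) (S ─ A)
    X  = crossWeight w A (S ─ A)

  surplus-∣S∣≡1 : ∀ {S} → ∣ S ∣ ≡ 1 → surplus S ≡ 0ℚ
  surplus-∣S∣≡1 {S} ∣S∣≡1 = begin
    surplus S
      ≡⟨ cong₂ (λ c k → c - (d + d) * (fromℕ k - 1ℚ)) (crossWeight-∣S∣≤1 w no-loops {S} (ℕₚ.≤-reflexive ∣S∣≡1)) ∣S∣≡1 ⟩
    0ℚ - (d + d) * 0ℚ
      ≡⟨ cong (λ y → 0ℚ - y) (*-zeroʳ (d + d)) ⟩
    0ℚ
      ∎
    where open ≡-Reasoning

  positive-surplus⇒2≤∣S∣ : ∀ {S} → Nonempty S → 0ℚ < surplus S → 2 ≤ℕ ∣ S ∣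
  positive-surplus⇒2≤∣S∣ {S} (x , x∈S) 0<surplus with 2 ℕ.≤? ∣ S ∣
  ... | yes 2≤∣S∣ = 2≤∣S∣
  ... | no  2≰∣S∣ = contradiction 0<surplus (<-irrefl (sym (surplus-∣S∣≡1 {S} ∣S∣≡1)))
    where
    ∣S∣≡1 : ∣ S ∣ ≡ 1
    ∣S∣≡1 = ℕₚ.≤-antisym (ℕₚ.≤-pred (ℕₚ.≰⇒> 2≰∣S∣)) (x∈p⇒1≤∣p∣ x∈S)

  surplus-⊤-nonneg : 1 ≤ℕ n → d * fromℕ (n ∸ 1) ≤ totalWeight w → 0ℚ ≤ surplus ⊤
  surplus-⊤-nonneg 1≤n d[n-1]≤W = begin
    0ℚ
      ≡⟨ solve 2 (λ d k → con 0ℚ := (d :* k :+ d :* k) :- (d :+ d) :* ((k :+ con 1ℚ) :- con 1ℚ)) refl d k ⟩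
    (d * k + d * k) - (d + d) * ((k + 1ℚ) - 1ℚ)
      ≤⟨ +-monoˡ-≤ (- ((d + d) * ((k + 1ℚ) - 1ℚ))) (+-mono-≤ d[n-1]≤W d[n-1]≤W) ⟩
    (totalWeight w + totalWeight w) - (d + d) * ((k + 1ℚ) - 1ℚ)
      ≡⟨ cong₂ (λ c m → c - (d + d) * (m - 1ℚ)) (crossWeight-⊤≡2totalWeight w sym-w no-loops) fromℕ∣⊤∣ ⟨
    surplus ⊤
      ∎
    where
    open ≤-Reasoning
    k : ℚ
    k = fromℕ (n ∸ 1)
    fromℕ∣⊤∣ : fromℕ ∣ ⊤ {n} ∣ ≡ k + 1ℚ
    fromℕ∣⊤∣ = trans (cong fromℕ (trans (∣⊤∣≡n n) (sym (ℕₚ.m∸n+n≡m 1≤n)))) (fromℕ-homo-+ (n ∸ 1) 1)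

  weakCut⇒positiveSide : ∀ {S A} → 0ℚ ≤ surplus S → WeakCut w d S A →
                         ∃ λ T → T ⊂ S × Nonempty T × 0ℚ < surplus T
  weakCut⇒positiveSide {S} {A} 0≤surplus (A⊆S , A≢∅ , S─A≢∅ , X<d)
    with positive-summand 0≤surplus (surplus-split A⊆S) (+-mono-< X<d X<d)
  ... | inj₁ 0<surplusA = A , q⊆p∧p─q≢∅⇒q⊂p A⊆S S─A≢∅ , A≢∅ , 0<surplusA
  ... | inj₂ 0<surplusB = S ─ A , q⊆p∧q≢∅⇒p─q⊂p A⊆S A≢∅ , S─A≢∅ , 0<surplusB

  stronglyConnectedSubgraph : ∀ S → Acc _⊂_ S → 2 ≤ℕ ∣ S ∣ → 0ℚ ≤ surplus S →
                              Σ (Subset n) (λ T → (2 ≤ℕ ∣ T ∣) × StronglyConnected w d T)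
  stronglyConnectedSubgraph S (acc rec) 2≤∣S∣ 0≤surplus with stronglyConnected⊎weakCut w d S
  ... | inj₁ connected = S , 2≤∣S∣ , connected
  ... | inj₂ (A , cut) = descend (weakCut⇒positiveSide 0≤surplus cut)
    where
    descend : (∃ λ T → T ⊂ S × Nonempty T × 0ℚ < surplus T) →
              Σ (Subset n) (λ T → (2 ≤ℕ ∣ T ∣) × StronglyConnected w d T)
    descend (T , T⊂S , T≢∅ , 0<surplusT) =
      stronglyConnectedSubgraph T (rec T⊂S) (positive-surplus⇒2≤∣S∣ T≢∅ 0<surplusT) (<⇒≤ 0<surplusT)

lemma3p8 : (n : ℕ) → 2 ≤ℕ n → (w : Weight n) → Symmetric w → NonNegative w → NoSelfLoops w →
    (d : ℚ) → d * ((+ (n ∸ 1)) / 1) ≤ totalWeight w →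
    Σ (Subset n) (λ S → (2 ≤ℕ ∣ S ∣) × StronglyConnected w d S)
lemma3p8 n 2≤n w sym-w _ no-loops d d[n-1]≤W =
  stronglyConnectedSubgraph ⊤ (⊂-wellFounded ⊤) (subst (2 ≤ℕ_) (sym (∣⊤∣≡n n)) 2≤n)
                            (surplus-⊤-nonneg (ℕₚ.≤-trans (s≤s z≤n) 2≤n) d[n-1]≤W)
  where open Surplus w sym-w no-loops d
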